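{- Let $P\in\mathcal P(w_0^{(n+1)})$ and for $i\in[n]$ let $m_i(P)$ be the top element of $P$ in column $i$. If $\mathrm{ind}_{\mathsf A}(P)=0$ then $m_1(P)<_P m_2(P)<_P\cdots<_P m_n(P)$ and $m_n(P)$ is the maximum element of $P$. If $\mathrm{ind}_{\mathsf D}(P)=0$ then $m_1(P)>_P m_2(P)>_P\cdots>_P m_n(P)$ and $m_1(P)$ is the maximum element of $P$.
   Context: Let $w_0^{(n+1)}$ be the longest element of the symmetric group $\mathfrak S_{n+1}$ (simple transpositions $s_i=(i,i+1)$); $\mathscr R(w)$ is the set of reduced words of $w$. A word poset is a finite poset $P$ with $f_P:P\to\mathbb{Z}_{>0}$; $x$ is in column $f_P(x)$; $P\sim Q$ if there is a poset isomorphism $\phi$ with $f_Q\circ\phi=f_P$. For $\mathbf i=(i_1,\dots,i_\ell)\in\mathscr R(w)$, $P_{\mathbf i}$ is the poset on $[\ell]$ generated by $j<k$ for $j<k$ with $|i_j-i_k|=1$, with $f_{P_{\mathbf i}}(j)=i_j$; $\mathcal P(w)$ is the set of word posets isomorphic to some $P_{\mathbf i}$. For $P\in\mathcal P(w_0^{(n+1)})$ the elements of each column form a nonempty chain; a top element is an $x$ with $y\le_P x$ for all $y$ with $f_P(y)=f_P(x)$. There is a unique chain $\mathsf D(P)=\{d_1<_P\cdots<_P d_n\}$ with $f_P(d_i)=n+1-i$ and a unique chain $\mathsf A(P)=\{a_1<_P\cdots<_P a_n\}$ with $f_P(a_i)=i$. $\mathrm{ind}_{\mathsf D}(P)=\sum_i\#\{k: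 k>_P d_i,\ f_P(k)=f_P(d_i)\}$, $\mathrm{ind}_{\mathsf A}(P)=\sum_i\#\{k: k>_P a_i,\ f_P(k)=f_P(a_i)\}$. -}

module Defs where

open import Level using (0ℓ)
open import Data.Nat using (ℕ; zero; suc; _+_; _∸_; _≤_; _<_; _≟_)
open import Data.Fin using (Fin; toℕ)
open import Data.Fin.Properties using () renaming (_≟_ to _≟F_)
open import Data.List using (List; []; _∷_; length; lookup; filter; allFin)
open import Data.List.Relation.Unary.All using (All)
open import Data.Product using (Σ; _×_; _,_; ∃)
open import Data.Sum using (_⊎_)
open import Relation.Nullary using (¬_; Dec; yes; no; does)
open import Relation.Nullary.Decidable using (_×-dec_; ¬?)
open import Relation.Binary using (Rel; Decidable; IsPartialOrder)
open import Relation.Binary.PropositionalEquality using (_≡_; _≢_)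
open import Relation.Binary.Construct.Closure.ReflexiveTransitive using (Star)
open import Function.Bundles using (Bijection)
open import Function using (_⇔_)
open import Data.Bool using (if_then_else_)

s : ℕ → ℕ → ℕ
s i x = if does (x ≟ i) then suc i else (if does (x ≟ suc i) then i else x)

act : List ℕ → ℕ → ℕ
act [] x = x
act (i ∷ w) x = s i (act w x)

ValidWord : ℕ → List ℕ → Set
ValidWord n w = All (λ i → (1 ≤ i) × (i ≤ n)) w

RepW0 : ℕ → List ℕ → Set
RepW0 n w = ∀ x → 1 ≤ x → x ≤ suc n → act w x ≡ (suc (suc n)) ∸ x

ReducedW0 : ℕ → List ℕ → Set
ReducedW0 n w = ValidWord n w × RepW0 n w ×
  (∀ v → ValidWord n v → RepW0 n v → length w ≤ length v)

Gen : (w : List ℕ) → Rel (Fin (length w)) 0ℓ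
Gen w j k = (toℕ j < toℕ k) ×
  ((lookup w j ≡ suc (lookup w k)) ⊎ (lookup w k ≡ suc (lookup w j)))

OrdW : (w : List ℕ) → Rel (Fin (length w)) 0ℓ
OrdW w = Star (Gen w)

record WordPoset : Set₁ where
  field
    size  : ℕ
    _≼_   : Rel (Fin size) 0ℓ
    isPO  : IsPartialOrder _≡_ _≼_
    dec≼  : Decidable _≼_
    col   : Fin size → ℕ
    colPos : ∀ x → 1 ≤ col x

  _≺_ : Rel (Fin size) 0ℓ
  x ≺ y = (x ≼ y) × (x ≢ y)

  _≺?_ : Decidable _≺_
  x ≺? y = dec≼ x y ×-dec ¬? (x ≟F y)

  above : Fin size → ℕ
  above x = length (filter (λ k → (x ≺? k) ×-dec (col k ≟ col x)) (allFin size))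

open WordPoset public

IsoToWord : WordPoset → List ℕ → Set
IsoToWord P w = Σ (Bijection (≡-setoid (Fin (size P))) (≡-setoid (Fin (length w)))) λ φ →
    (∀ x y → (_≼_ P x y) ⇔ OrdW w (Bijection.to φ x) (Bijection.to φ y))
  × (∀ x → lookup w (Bijection.to φ x) ≡ col P x)
  where open import Relation.Binary.PropositionalEquality using () renaming (setoid to ≡-setoid)

InPW0 : ℕ → WordPoset → Set
InPW0 n P = ∃ λ w → ReducedW0 n w × IsoToWord P w

IsTop : (P : WordPoset) → ℕ → Fin (size P) → Set
IsTop P i m = (col P m ≡ i) × (∀ y → col P y ≡ i → _≼_ P y m)

Tops : (n : ℕ) (P : WordPoset) → (ℕ → Fin (size P)) → Set
Tops n P m = ∀ i → 1 ≤ i → i ≤ n → IsTop P i (m i)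

IsAChain : (n : ℕ) (P : WordPoset) → (ℕ → Fin (size P)) → Set
IsAChain n P a = (∀ i → 1 ≤ i → i ≤ n → col P (a i) ≡ i)
               × (∀ i → 1 ≤ i → i < n → _≺_ P (a i) (a (suc i)))

IsDChain : (n : ℕ) (P : WordPoset) → (ℕ → Fin (size P)) → Set
IsDChain n P d = (∀ i → 1 ≤ i → i ≤ n → col P (d i) ≡ suc n ∸ i)
               × (∀ i → 1 ≤ i → i < n → _≺_ P (d i) (d (suc i)))

indSum : (P : WordPoset) → (ℕ → Fin (size P)) → ℕ → ℕ
indSum P c zero = 0
indSum P c (suc k) = indSum P c k + above P (c (suc k))

-- With ind_A(P) = 0 every a_i has nothing above it in its column, so a_i is the
-- top m_i and the chain 𝖠(P) is the chain of tops; likewise d_i = m_{n+1-i} when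
-- ind_D(P) = 0. Any y lies below the top of its column, which in turn lies below
-- the last (resp. first) top of that chain, so that top is the maximum of P.
module Submission where

open import Defs
open import Data.Nat using (ℕ; zero; suc; _∸_; _≤_; _<_; s≤s; z≤n; _≟_)
open import Data.Nat.Properties
open import Data.Fin using (Fin)
open import Data.Fin.Properties using () renaming (_≟_ to _≟F_)
open import Data.Product using (_×_; _,_; proj₁; proj₂)
open import Data.Sum using (inj₁; inj₂)
open import Data.List using (List; _∷_; length; filter; allFin)
open import Data.List.Relation.Unary.All as All using ()
open import Data.List.Membership.Propositional using (_∈_)
open import Data.List.Membership.Propositional.Properties using (∈-filter⁺; ∈-allFin; ∈-lookup)
open import Function using (flip)
open import Function.Bundles using (Bijection)
open import Relation.Nullary using (yes; no; contradiction; _×-dec_)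
open import Relation.Binary using (Rel; Reflexive; Transitive; IsPartialOrder; IsPreorder)
open import Relation.Binary.PropositionalEquality using (_≡_; _≢_; refl; sym; trans; cong; subst; subst₂)

∈⇒length≢0 : ∀ {A : Set} {x : A} {xs : List A} → x ∈ xs → length xs ≢ 0
∈⇒length≢0 {xs = _ ∷ _} _ ()

chain⇒related : ∀ {ℓ} {A : Set} (R : Rel A ℓ) → Reflexive R → Transitive R →
  (n : ℕ) (c : ℕ → A) → (∀ i → 1 ≤ i → i < n → R (c i) (c (suc i))) →
  ∀ {j k} → 1 ≤ j → j ≤ k → k ≤ n → R (c j) (c k)
chain⇒related R refl′ trans′ n c step {j} {zero} 1≤j j≤k k≤n =
  contradiction (≤-trans 1≤j j≤k) λ ()
chain⇒related R refl′ trans′ n c step {j} {suc k} 1≤j j≤k k≤n with m≤n⇒m<n∨m≡n j≤k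
... | inj₂ refl = refl′
... | inj₁ (s≤s j≤k′) =
  trans′ (chain⇒related R refl′ trans′ n c step 1≤j j≤k′ (≤-trans (n≤1+n k) k≤n))
         (step k (≤-trans 1≤j j≤k′) k≤n)

module _ (P : WordPoset) where
  open WordPoset P using () renaming (_≼_ to _≤P_; _≺?_ to _<P?_)

  ≤P-isPreorder : IsPreorder _≡_ _≤P_
  ≤P-isPreorder = IsPartialOrder.isPreorder (isPO P)

  ≤P-refl : Reflexive _≤P_
  ≤P-refl = IsPreorder.refl ≤P-isPreorder

  ≤P-trans : Transitive _≤P_
  ≤P-trans = IsPreorder.trans ≤P-isPreorder

  above≡0⇒top : ∀ {i x t} → IsTop P i t → col P x ≡ i → above P x ≡ 0 → x ≡ t
  above≡0⇒top {x = x} {t} (col-t , t-top) col-x above-x with x ≟F t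
  ... | yes x≡t = x≡t
  ... | no x≢t = contradiction above-x (∈⇒length≢0 t∈above)
    where
    t∈above : t ∈ filter (λ k → (x <P? k) ×-dec (col P k ≟ col P x)) (allFin (size P))
    t∈above = ∈-filter⁺ _ (∈-allFin t) ((t-top x col-x , x≢t) , trans col-t (sym col-x))

  indSum≡0⇒above≡0 : ∀ c k → indSum P c k ≡ 0 → ∀ {i} → 1 ≤ i → i ≤ k → above P (c i) ≡ 0
  indSum≡0⇒above≡0 c zero _ 1≤i i≤0 = contradiction (≤-trans 1≤i i≤0) λ ()
  indSum≡0⇒above≡0 c (suc k) sum≡0 {i} 1≤i i≤k with i ≟ suc k
  ... | yes refl = m+n≡0⇒n≡0 (indSum P c k) sum≡0
  ... | no i≢k = indSum≡0⇒above≡0 c k (m+n≡0⇒m≡0 _ sum≡0) 1≤i (≤-pred (≤∧≢⇒< i≤k i≢k))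

  col≤n : ∀ {n} → InPW0 n P → ∀ y → col P y ≤ n
  col≤n {n} (_ , (valid , _) , (φ , _ , lookup≡col)) y =
    subst (_≤ n) (lookup≡col y) (proj₂ (All.lookup valid (∈-lookup (Bijection.to φ y))))

  ≤P-top : ∀ {n m} → InPW0 n P → Tops n P m → ∀ y → y ≤P m (col P y)
  ≤P-top inP tops y = proj₂ (tops (col P y) (colPos P y) (col≤n inP y)) y refl

  indSum≡0⇒tops : ∀ {n m} c → Tops n P m → indSum P c n ≡ 0 →
    ∀ {i j} → 1 ≤ i → i ≤ n → 1 ≤ j → j ≤ n → col P (c i) ≡ j → c i ≡ m j
  indSum≡0⇒tops {n} c tops sum≡0 1≤i i≤n 1≤j j≤n col≡j =
    above≡0⇒top (tops _ 1≤j j≤n) col≡j (indSum≡0⇒above≡0 c n sum≡0 1≤i i≤n)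

module _ (P : WordPoset) {n : ℕ} (inP : InPW0 n P) {m : ℕ → Fin (size P)} (tops : Tops n P m) where
  open WordPoset P using () renaming (_≼_ to _≤P_; _≺_ to _<P_)

  ind𝖠≡0⇒tops-ascend : ∀ a → IsAChain n P a → indSum P a n ≡ 0 →
    (∀ i → 1 ≤ i → i < n → m i <P m (suc i)) × (∀ y → y ≤P m n)
  ind𝖠≡0⇒tops-ascend a (col-a , a-chain) sum≡0 = m-chain , m-max
    where
    a≡m : ∀ {i} → 1 ≤ i → i ≤ n → a i ≡ m i
    a≡m 1≤i i≤n = indSum≡0⇒tops P a tops sum≡0 1≤i i≤n 1≤i i≤n (col-a _ 1≤i i≤n)

    m-chain : ∀ i → 1 ≤ i → i < n → m i <P m (suc i)
    m-chain i 1≤i i<n = subst₂ _<P_ (a≡m 1≤i (<⇒≤ i<n)) (a≡m (s≤s z≤n) i<n) (a-chain i 1≤i i<n)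

    m-max : ∀ y → y ≤P m n
    m-max y = ≤P-trans P (≤P-top P inP tops y)
      (chain⇒related _≤P_ (≤P-refl P) (≤P-trans P) n m (λ i p q → proj₁ (m-chain i p q))
        (colPos P y) (col≤n P inP y) ≤-refl)

  ind𝖣≡0⇒tops-descend : ∀ d → IsDChain n P d → indSum P d n ≡ 0 →
    (∀ i → 1 ≤ i → i < n → m (suc i) <P m i) × (∀ y → y ≤P m 1)
  ind𝖣≡0⇒tops-descend d (col-d , d-chain) sum≡0 = m-chain , m-max
    where
    m-chain : ∀ i → 1 ≤ i → i < n → m (suc i) <P m i
    m-chain i 1≤i i<n = subst₂ _<P_ d≡m[1+i] d≡m[i] (d-chain (n ∸ i) 1≤n∸i n∸i<n)
      where
      1≤n∸i : 1 ≤ n ∸ i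
      1≤n∸i = m<n⇒0<n∸m i<n

      n∸i<n : n ∸ i < n
      n∸i<n = ∸-monoʳ-< 1≤i (<⇒≤ i<n)

      n∸[n∸i]≡i : n ∸ (n ∸ i) ≡ i
      n∸[n∸i]≡i = m∸[m∸n]≡n (<⇒≤ i<n)

      1+n∸[n∸i]≡1+i : suc n ∸ (n ∸ i) ≡ suc i
      1+n∸[n∸i]≡1+i = trans (+-∸-assoc 1 (m∸n≤m n i)) (cong suc n∸[n∸i]≡i)

      d≡m[1+i] : d (n ∸ i) ≡ m (suc i)
      d≡m[1+i] = indSum≡0⇒tops P d tops sum≡0 1≤n∸i (<⇒≤ n∸i<n) (s≤s z≤n) i<n
        (trans (col-d _ 1≤n∸i (<⇒≤ n∸i<n)) 1+n∸[n∸i]≡1+i)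

      d≡m[i] : d (suc (n ∸ i)) ≡ m i
      d≡m[i] = indSum≡0⇒tops P d tops sum≡0 (s≤s z≤n) n∸i<n 1≤i (<⇒≤ i<n)
        (trans (col-d _ (s≤s z≤n) n∸i<n) n∸[n∸i]≡i)

    m-max : ∀ y → y ≤P m 1
    m-max y = ≤P-trans P (≤P-top P inP tops y)
      (chain⇒related (flip _≤P_) (≤P-refl P) (flip (≤P-trans P)) n m (λ i p q → proj₁ (m-chain i p q))
        ≤-refl (colPos P y) (col≤n P inP y))

lemma4p7 : (n : ℕ) (P : WordPoset) → InPW0 n P →
    (m : ℕ → Fin (size P)) → Tops n P m →
      (∀ (a : ℕ → Fin (size P)) → IsAChain n P a → indSum P a n ≡ 0 →
          (∀ i → 1 ≤ i → i < n → _≺_ P (m i) (m (suc i)))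
        × (∀ y → _≼_ P y (m n)))
    × (∀ (d : ℕ → Fin (size P)) → IsDChain n P d → indSum P d n ≡ 0 →
          (∀ i → 1 ≤ i → i < n → _≺_ P (m (suc i)) (m i))
        × (∀ y → _≼_ P y (m 1)))
lemma4p7 n P inP m tops = ind𝖠≡0⇒tops-ascend P inP tops , ind𝖣≡0⇒tops-descend P inP tops
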